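{- Let $G$ be a graph with vertex set $\{v_1,\dots,v_k\}$, let $M_i=(V_i,E_i)$, $1\le i\le k$, be pairwise vertex-disjoint graphs, and let $H$ be the graph obtained from $G$ by expanding each $v_i$ by the module $M_i$. Let $S$ be a minimal separator of $H$, and suppose some $V_i$ intersects $S$ but is not contained in $S$. Then $V_i$ intersects every full component of $H-S$ associated to $S$. In particular $S\cap V_i$ is a minimal separator of $M_i$ and $S\setminus V_i=N_H(V_i)$.
   Context: The expansion $H$ has vertex set $V_1\cup\dots\cup V_k$ and edge set $E_1\cup\dots\cup E_k\cup\{ab\mid a\in V_i,\ b\in V_j,\ v_iv_j\in E(G)\}$. $N_H(A)=\bigcup_{v\in A}N_H(v)\setminus A$; $H-S$ is the subgraph induced by the complement of $S$. A minimal separator of a graph is a vertex set that is an inclusion-minimal $u,v$-separator for some pair of vertices $u,v$ (a $u,v$-separator being a set whose removal puts $u$ and $v$ in different components). A component $C$ of $H-S$ is a full component associated to $S$ if $N_H(C)=S$. -}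

module Defs where

open import Data.Nat using (ℕ)
open import Data.Fin using (Fin; _≟_)
open import Data.Bool using (Bool; true; false)
open import Data.Product using (Σ; ∃; _×_; _,_; proj₁)
open import Relation.Nullary using (¬_; yes; no)
open import Relation.Binary.PropositionalEquality using (_≡_; refl)
open import Function.Bundles using (_⇔_)
open import Data.Empty using (⊥-elim)

-- A finite simple graph on vertex type V: Bool-valued, symmetric, irreflexive
-- adjacency.  Vertex subsets are Bool-valued (every subset of a finite set is
-- decidable); "x ∈ S" is  S x ≡ true.
record SimpleGraph (V : Set) : Set where
  field
    adj    : V → V → Bool
    adj-sym    : ∀ x y → adj x y ≡ adj y x
    adj-irrefl : ∀ x → adj x x ≡ false
open SimpleGraph public

VSet : Set → Set
VSet V = V → Bool

module _ {V : Set} (Γ : SimpleGraph V) where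

  data Reach (S : VSet V) : V → V → Set where
    here : ∀ {x} → S x ≡ false → Reach S x x
    step : ∀ {x y z} → Reach S x y → adj Γ y z ≡ true → S z ≡ false → Reach S x z

  Separates : VSet V → V → V → Set
  Separates S u v = (S u ≡ false) × (S v ≡ false) × ¬ Reach S u v

  MinSepFor : VSet V → V → V → Set
  MinSepFor S u v =
    Separates S u v ×
    (∀ (T : VSet V) → (∀ x → T x ≡ true → S x ≡ true) → Separates T u v →
       ∀ x → S x ≡ true → T x ≡ true)

  MinimalSeparator : VSet V → Set
  MinimalSeparator S = Σ V λ u → Σ V λ v → MinSepFor S u v

  IsComponent : VSet V → (V → Set) → Set
  IsComponent S C = Σ V λ x → (S x ≡ false) × (∀ y → C y ⇔ Reach S x y)

  Nbhd : (V → Set) → V → Set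
  Nbhd A v = ¬ A v × Σ V λ a → A a × (adj Γ a v ≡ true)

  IsFullComponent : VSet V → (V → Set) → Set
  IsFullComponent S C = IsComponent S C × (∀ v → (S v ≡ true) ⇔ Nbhd C v)

-- Expansion of G (vertices v_i = Fin k) by modules M_i on vertex sets
-- V_i = Fin (n i); H has vertex set Σ i. V_i (pairwise disjoint by construction).
expandAdj : ∀ {k} {n : Fin k → ℕ} → SimpleGraph (Fin k) →
            ((i : Fin k) → SimpleGraph (Fin (n i))) →
            Σ (Fin k) (λ i → Fin (n i)) → Σ (Fin k) (λ i → Fin (n i)) → Bool
expandAdj G M (i , a) (j , b) with i ≟ j
... | yes refl = adj (M i) a b
... | no _     = adj G i j

private
  expandSym : ∀ {k} {n : Fin k → ℕ} (G : SimpleGraph (Fin k))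
              (M : (i : Fin k) → SimpleGraph (Fin (n i))) →
              ∀ x y → expandAdj G M x y ≡ expandAdj G M y x
  expandSym G M (i , a) (j , b) with i ≟ j | j ≟ i
  ... | yes refl | yes refl = adj-sym (M i) a b
  ... | yes refl | no ¬p = ⊥-elim (¬p refl)
  ... | no ¬p | yes refl = ⊥-elim (¬p refl)
  ... | no _ | no _ = adj-sym G i j

  expandIrrefl : ∀ {k} {n : Fin k → ℕ} (G : SimpleGraph (Fin k))
                 (M : (i : Fin k) → SimpleGraph (Fin (n i))) →
                 ∀ x → expandAdj G M x x ≡ false
  expandIrrefl G M (i , a) with i ≟ i
  ... | yes refl = adj-irrefl (M i) a
  ... | no ¬p = ⊥-elim (¬p refl)

expand : ∀ {k} {n : Fin k → ℕ} → SimpleGraph (Fin k) →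
         ((i : Fin k) → SimpleGraph (Fin (n i))) →
         SimpleGraph (Σ (Fin k) (λ i → Fin (n i)))
expand G M = record { adj = expandAdj G M ; adj-sym = expandSym G M ; adj-irrefl = expandIrrefl G M }

module Submission where

-- Let C_u, C_v be the components of H − S containing u and v, where S is a minimal
-- u,v-separator. Minimality makes both full: every s ∈ S has a neighbour in each.
-- A neighbour of a vertex of S ∩ V_i lies in V_i or, being outside the module, is
-- adjacent to all of V_i and so to a vertex of V_i ∖ S; hence C_u and C_v both meet V_i.
-- A vertex of N_H(V_i) outside S would then join C_u to C_v, so N_H(V_i) ⊆ S, and
-- every walk of H − S starting in V_i is a walk of M_i − S. Therefore u, v ∈ V_i,
-- C_u and C_v witness that S ∩ V_i is a minimal u,v-separator of M_i, and every
-- s ∈ S ∖ V_i, being adjacent to C_u ⊆ V_i, lies in N_H(V_i).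
-- Fullness is obtained only doubly negated; it is used only towards decidable goals.

open import Defs
open import Data.Nat using (ℕ)
open import Data.Fin using (Fin; _≟_)
open import Data.Fin.Properties using (any?)
open import Data.Bool using (true; false)
open import Data.Bool.Properties using (¬-not; not-¬) renaming (_≟_ to _≟ᵇ_)
open import Data.Empty using (⊥-elim)
open import Data.Product using (Σ; _×_; _,_; proj₁; proj₂)
open import Data.Product.Properties using (≡-dec)
open import Data.Sum using (_⊎_; inj₁; inj₂; [_,_]′)
open import Function using (_∘_)
open import Function.Bundles using (_⇔_; mk⇔; Equivalence)
open import Relation.Binary.Definitions using (DecidableEquality)
open import Relation.Binary.PropositionalEquality using (_≡_; _≢_; refl; sym; trans; cong)
open import Relation.Nullary using (¬_; yes; no)
open import Relation.Nullary.Decidable.Core using (decidable-stable)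
open import Relation.Nullary.Negation.Core using (¬¬-map)

_⊆_ : {V : Set} → VSet V → VSet V → Set
T ⊆ S = ∀ x → T x ≡ true → S x ≡ true

⊆-complement : {V : Set} {T S : VSet V} → T ⊆ S → ∀ {z} → S z ≡ false → T z ≡ false
⊆-complement T⊆S z∉S = ¬-not λ z∈T → not-¬ (T⊆S _ z∈T) z∉S

module _ {V : Set} {Γ : SimpleGraph V} where

  Reach-target∉ : ∀ {S x y} → Reach Γ S x y → S y ≡ false
  Reach-target∉ (here y∉S)     = y∉S
  Reach-target∉ (step _ _ y∉S) = y∉S

  Reach-trans : ∀ {S x y z} → Reach Γ S x y → Reach Γ S y z → Reach Γ S x z
  Reach-trans r (here _)       = r
  Reach-trans r (step r′ e z∉S) = step (Reach-trans r r′) e z∉S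

  Reach-cons : ∀ {S x y z} → adj Γ x y ≡ true → S x ≡ false → Reach Γ S y z → Reach Γ S x z
  Reach-cons e x∉S (here y∉S)      = step (here x∉S) e y∉S
  Reach-cons e x∉S (step r e′ z∉S) = step (Reach-cons e x∉S r) e′ z∉S

  Reach-sym : ∀ {S x y} → Reach Γ S x y → Reach Γ S y x
  Reach-sym (here x∉S)                      = here x∉S
  Reach-sym (step {y = y} {z = z} r e z∉S) = Reach-cons (trans (adj-sym Γ z y) e) z∉S (Reach-sym r)

  Reach-mono : ∀ {S T x y} → (∀ {z} → S z ≡ false → T z ≡ false) → Reach Γ S x y → Reach Γ T x y
  Reach-mono f (here x∉S)     = here (f x∉S)
  Reach-mono f (step r e z∉S) = step (Reach-mono f r) e (f z∉S)

module _ {V : Set} (Γ : SimpleGraph V) where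

  AdjacentToComponent : VSet V → V → V → Set
  AdjacentToComponent S u s = Σ V λ y → Reach Γ S u y × adj Γ y s ≡ true

  Reach-adjacent : ∀ {S T u s} → T ⊆ S → T s ≡ false → AdjacentToComponent S u s → Reach Γ T u s
  Reach-adjacent T⊆S s∉T (_ , r , e) = step (Reach-mono (⊆-complement T⊆S) r) e s∉T

  MinSepFor-sym : ∀ {S u v} → MinSepFor Γ S u v → MinSepFor Γ S v u
  MinSepFor-sym ((u∉S , v∉S , ¬reach) , minimal) =
    (v∉S , u∉S , ¬reach ∘ Reach-sym) ,
    λ T T⊆S (v∉T , u∉T , ¬reachT) → minimal T T⊆S (u∉T , v∉T , ¬reachT ∘ Reach-sym)

  ¬¬adjacent⇒MinSepFor : ∀ {S u v} → Separates Γ S u v →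
                         (∀ s → S s ≡ true → ¬ ¬ AdjacentToComponent S u s) →
                         (∀ s → S s ≡ true → ¬ ¬ AdjacentToComponent S v s) →
                         MinSepFor Γ S u v
  ¬¬adjacent⇒MinSepFor {S} {u} {v} sep adjacentᵤ adjacentᵥ = sep , minimal
    where
    minimal : ∀ T → T ⊆ S → Separates Γ T u v → ∀ x → S x ≡ true → T x ≡ true
    minimal T T⊆S (_ , _ , ¬reach) x x∈S = ¬-not λ x∉T →
      adjacentᵤ x x∈S λ cᵤ → adjacentᵥ x x∈S λ cᵥ →
      ¬reach (Reach-trans (Reach-adjacent T⊆S x∉T cᵤ) (Reach-sym (Reach-adjacent T⊆S x∉T cᵥ)))

  module _ (_≟ᵥ_ : DecidableEquality V) where

    _-_ : VSet V → V → VSet V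
    (S - s) z with z ≟ᵥ s
    ... | yes _ = false
    ... | no _  = S z

    -⊆ : ∀ {S s} → (S - s) ⊆ S
    -⊆ {s = s} z z∈T with z ≟ᵥ s
    ... | no _ = z∈T

    -self : ∀ {S s} → (S - s) s ≡ false
    -self {s = s} with s ≟ᵥ s
    ... | yes _  = refl
    ... | no s≢s = ⊥-elim (s≢s refl)

    -- Cut a walk avoiding S − s at its first visit to s.
    Reach-split : ∀ {S s x w} → S x ≡ false → Reach Γ (S - s) x w →
                  Reach Γ S x w ⊎ AdjacentToComponent S x s
    Reach-split x∉S (here _) = inj₁ (here x∉S)
    Reach-split {s = s} x∉S (step {y = y} {z = z} r e z∉T) with Reach-split x∉S r
    ... | inj₂ adjacent = inj₂ adjacent
    ... | inj₁ r′ with z ≟ᵥ s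
    ...   | yes refl = inj₂ (y , r′ , e)
    ...   | no _     = inj₁ (step r′ e z∉T)

    -- By minimality S − s does not separate u from v.
    MinSepFor⇒¬¬adjacent : ∀ {S u v s} → MinSepFor Γ S u v → S s ≡ true →
                           ¬ ¬ AdjacentToComponent S u s
    MinSepFor⇒¬¬adjacent {S} {u} {v} {s} ((u∉S , v∉S , ¬reach) , minimal) s∈S ¬adjacent =
      not-¬ (minimal (S - s) -⊆ separates s s∈S) (-self {S})
      where
      separates : Separates Γ (S - s) u v
      separates = ⊆-complement -⊆ u∉S , ⊆-complement -⊆ v∉S ,
                  λ r → [ ¬reach , ¬adjacent ]′ (Reach-split u∉S r)

module Expansion {k : ℕ} {n : Fin k → ℕ} (G : SimpleGraph (Fin k))
                 (M : (i : Fin k) → SimpleGraph (Fin (n i))) where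

  W : Set
  W = Σ (Fin k) (λ i → Fin (n i))

  H : SimpleGraph W
  H = expand G M

  _≟W_ : DecidableEquality W
  _≟W_ = ≡-dec _≟_ _≟_

  V[_] : Fin k → W → Set
  V[ i ] y = proj₁ y ≡ i

  _↾_ : VSet W → (i : Fin k) → VSet (Fin (n i))
  (S ↾ i) a = S (i , a)

  expandAdj-inside : ∀ {j} (a b : Fin (n j)) → adj H (j , a) (j , b) ≡ adj (M j) a b
  expandAdj-inside {j} a b with j ≟ j
  ... | yes refl = refl
  ... | no j≢j   = ⊥-elim (j≢j refl)

  expandAdj-across : ∀ {j l} (a : Fin (n j)) (b : Fin (n l)) → j ≢ l → adj H (j , a) (l , b) ≡ adj G j l
  expandAdj-across {j} {l} a b j≢l with j ≟ l
  ... | yes refl = ⊥-elim (j≢l refl)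
  ... | no _     = refl

  expandAdj-across-constant : ∀ {j l} {a a′ : Fin (n j)} {b b′ : Fin (n l)} → j ≢ l →
                              adj H (j , a) (l , b) ≡ adj H (j , a′) (l , b′)
  expandAdj-across-constant j≢l = trans (expandAdj-across _ _ j≢l) (sym (expandAdj-across _ _ j≢l))

  module ForSeparator (S : VSet W) (i : Fin k) where

    Reach-lift : ∀ {c d} → Reach (M i) (S ↾ i) c d → Reach H S (i , c) (i , d)
    Reach-lift (here c∉S)     = here c∉S
    Reach-lift (step r e d∉S) = step (Reach-lift r) (trans (expandAdj-inside _ _) e) d∉S

    Reach-into-module : ∀ {b₀ c x y} → S (i , b₀) ≡ false → Reach H S x y → adj H y (i , c) ≡ true →
                        Σ (Fin (n i)) λ a → Reach H S x (i , a)
    Reach-into-module {b₀} {y = j , d} b₀∉S r e with j ≟ i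
    ... | yes refl = d , r
    ... | no j≢i   = b₀ , step r (trans (expandAdj-across d b₀ j≢i) e) b₀∉S

    full-component-meets-module : ∀ {C a₀ b₀} → IsFullComponent H S C →
                                  S (i , a₀) ≡ true → S (i , b₀) ≡ false → Σ (Fin (n i)) λ a → C (i , a)
    full-component-meets-module {a₀ = a₀} ((_ , _ , C⇔) , S⇔N) a₀∈S b₀∉S =
      let (_ , y , y∈C , e) = Equivalence.to (S⇔N (i , a₀)) a₀∈S
          (a , r)           = Reach-into-module b₀∉S (Equivalence.to (C⇔ y) y∈C) e
      in a , Equivalence.from (C⇔ (i , a)) r

    ModuleNbhd⊆ : Set
    ModuleNbhd⊆ = ∀ w → Nbhd H V[ i ] w → S w ≡ true

    -- A vertex outside V_i that sees V_i sees all of it, so if it avoided S it would join u to v.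
    separated⇒ModuleNbhd⊆ : ∀ {u v a b} → ¬ Reach H S u v →
                            Reach H S u (i , a) → Reach H S v (i , b) → ModuleNbhd⊆
    separated⇒ModuleNbhd⊆ {a = a} {b} ¬reach rᵤ rᵥ (j , d) (j≢i , (_ , c) , refl , e) = ¬-not λ w∉S →
      ¬reach (Reach-trans (step (step rᵤ eᵤ w∉S) eᵥ (Reach-target∉ rᵥ)) (Reach-sym rᵥ))
      where
      i≢j : i ≢ j
      i≢j = j≢i ∘ sym
      eᵤ : adj H (i , a) (j , d) ≡ true
      eᵤ = trans (expandAdj-across-constant i≢j) e
      eᵥ : adj H (j , d) (i , b) ≡ true
      eᵥ = trans (adj-sym H (j , d) (i , b)) (trans (expandAdj-across-constant i≢j) e)

    Reach-within : ModuleNbhd⊆ → ∀ {c y} → Reach H S (i , c) y →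
                   Σ (Fin (n i)) λ d → (y ≡ (i , d)) × Reach (M i) (S ↾ i) c d
    Reach-within nbhd⊆ (here c∉S) = _ , refl , here c∉S
    Reach-within nbhd⊆ (step {z = j , d′} r e z∉S) with Reach-within nbhd⊆ r
    ... | d , refl , r′ with j ≟ i
    ...   | yes refl = d′ , refl , step r′ (trans (sym (expandAdj-inside d d′)) e) z∉S
    ...   | no j≢i   = ⊥-elim (not-¬ (nbhd⊆ (j , d′) (j≢i , (i , d) , refl , e)) z∉S)

    adjacent-restrict : ModuleNbhd⊆ → ∀ {a x} → AdjacentToComponent H S (i , a) (i , x) →
                        AdjacentToComponent (M i) (S ↾ i) a x
    adjacent-restrict nbhd⊆ {x = x} (_ , r , e) with Reach-within nbhd⊆ r
    ... | c , refl , r′ = c , r′ , trans (sym (expandAdj-inside c x)) e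

    MinSepFor⇒ModuleNbhd⊆ : ∀ {u v a₀ b₀} → MinSepFor H S u v →
                            S (i , a₀) ≡ true → S (i , b₀) ≡ false → ModuleNbhd⊆
    MinSepFor⇒ModuleNbhd⊆ minSep@((_ , _ , ¬reach) , _) a₀∈S b₀∉S w w∈N = ¬-not λ w∉S →
      MinSepFor⇒¬¬adjacent H _≟W_ minSep a₀∈S λ (_ , rᵤ , eᵤ) →
      MinSepFor⇒¬¬adjacent H _≟W_ (MinSepFor-sym H minSep) a₀∈S λ (_ , rᵥ , eᵥ) →
      not-¬ (separated⇒ModuleNbhd⊆ ¬reach (proj₂ (Reach-into-module b₀∉S rᵤ eᵤ))
                                          (proj₂ (Reach-into-module b₀∉S rᵥ eᵥ)) w w∈N) w∉S

    MinSepFor⇒source∈module : ∀ {u v a₀ b₀} → MinSepFor H S u v →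
                              S (i , a₀) ≡ true → S (i , b₀) ≡ false → V[ i ] u
    MinSepFor⇒source∈module {u} minSep a₀∈S b₀∉S =
      decidable-stable (proj₁ u ≟ i) λ u∉Vᵢ →
      MinSepFor⇒¬¬adjacent H _≟W_ minSep a₀∈S λ (_ , r , e) →
      let (_ , r′)     = Reach-into-module b₀∉S r e
          (_ , u≡ , _) = Reach-within (MinSepFor⇒ModuleNbhd⊆ minSep a₀∈S b₀∉S) (Reach-sym r′)
      in u∉Vᵢ (cong proj₁ u≡)

    MinSepFor⇒endpoints-in-module : ∀ {u v a₀ b₀} → MinSepFor H S u v →
                                    S (i , a₀) ≡ true → S (i , b₀) ≡ false →
                                    Σ (Fin (n i)) λ a → Σ (Fin (n i)) λ b → MinSepFor H S (i , a) (i , b)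
    MinSepFor⇒endpoints-in-module {_ , a} {_ , b} minSep a₀∈S b₀∉S
      with MinSepFor⇒source∈module minSep a₀∈S b₀∉S
         | MinSepFor⇒source∈module (MinSepFor-sym H minSep) a₀∈S b₀∉S
    ... | refl | refl = a , b , minSep

    MinSepFor-restrict : ModuleNbhd⊆ → ∀ {a b} → MinSepFor H S (i , a) (i , b) → MinSepFor (M i) (S ↾ i) a b
    MinSepFor-restrict nbhd⊆ minSep@((a∉S , b∉S , ¬reach) , _) =
      ¬¬adjacent⇒MinSepFor (M i) (a∉S , b∉S , ¬reach ∘ Reach-lift)
        (λ _ x∈S → ¬¬-map (adjacent-restrict nbhd⊆) (MinSepFor⇒¬¬adjacent H _≟W_ minSep x∈S))
        (λ _ x∈S → ¬¬-map (adjacent-restrict nbhd⊆) (MinSepFor⇒¬¬adjacent H _≟W_ (MinSepFor-sym H minSep) x∈S))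

    separator-outside-module⇔ModuleNbhd : ModuleNbhd⊆ → ∀ {a b} → MinSepFor H S (i , a) (i , b) →
                                          ∀ x → (S x ≡ true × proj₁ x ≢ i) ⇔ Nbhd H V[ i ] x
    separator-outside-module⇔ModuleNbhd nbhd⊆ minSep x = mk⇔ to (λ x∈N → nbhd⊆ x x∈N , proj₁ x∈N)
      where
      sees-module : ∀ {a} → AdjacentToComponent H S (i , a) x → Σ (Fin (n i)) λ c → adj H (i , c) x ≡ true
      sees-module (_ , r , e) with Reach-within nbhd⊆ r
      ... | c , refl , _ = c , e

      to : S x ≡ true × proj₁ x ≢ i → Nbhd H V[ i ] x
      to (x∈S , x∉Vᵢ) =
        let (c , e) = decidable-stable (any? λ c → adj H (i , c) x ≟ᵇ true)
                                       (¬¬-map sees-module (MinSepFor⇒¬¬adjacent H _≟W_ minSep x∈S))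
        in x∉Vᵢ , (i , c) , refl , e

lemma4 : ∀ {k : ℕ} {n : Fin k → ℕ} (G : SimpleGraph (Fin k))
           (M : (i : Fin k) → SimpleGraph (Fin (n i)))
           (S : VSet (Σ (Fin k) (λ i → Fin (n i)))) (i : Fin k) →
           MinimalSeparator (expand G M) S →
           Σ (Fin (n i)) (λ a → S (i , a) ≡ true) →
           Σ (Fin (n i)) (λ a → S (i , a) ≡ false) →
           (∀ (C : Σ (Fin k) (λ j → Fin (n j)) → Set) →
              IsFullComponent (expand G M) S C →
              Σ (Fin (n i)) (λ a → C (i , a)))
           × MinimalSeparator (M i) (λ a → S (i , a))
           × (∀ x → ((S x ≡ true) × (proj₁ x ≢ i)) ⇔ Nbhd (expand G M) (λ y → proj₁ y ≡ i) x)
lemma4 G M S i (_ , _ , minSep) (a₀ , a₀∈S) (_ , b₀∉S) =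
  let open Expansion G M
      open ForSeparator S i
      (a , b , minSepᵢ) = MinSepFor⇒endpoints-in-module minSep a₀∈S b₀∉S
      nbhd⊆ : ModuleNbhd⊆
      nbhd⊆ = MinSepFor⇒ModuleNbhd⊆ minSep a₀∈S b₀∉S
  in (λ _ full → full-component-meets-module full a₀∈S b₀∉S) ,
     (a , b , MinSepFor-restrict nbhd⊆ minSepᵢ) ,
     separator-outside-module⇔ModuleNbhd nbhd⊆ minSepᵢ
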